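{- Let $n\ge 2$ and let $\boldsymbol{\pi}\in\mathfrak{S}_n$ be an $Ln1$ permutation. Then for each $0\le k\le n-2$, the vector $s^k(\boldsymbol{\pi})-\mathbf{e}\in\mathbb{Z}^n$ ends with $(-n+k+1,0,0,\dots,0)$, with exactly $k$ trailing zeros; that is, its last $k$ coordinates are $0$ and its $(n-k)$-th coordinate is $-n+k+1$.
   Context: Permutations $\boldsymbol{\pi}=\pi_1\cdots\pi_n\in\mathfrak{S}_n$ are identified with points of $\mathbb{R}^n$; $\mathbf{e}=12\cdots n=(1,2,\dots,n)$. An $Ln1$ permutation is one with $\pi_{n-1}=n$ and $\pi_n=1$. The stack-sorting map $s$: start with an empty stack and read entries left to right; for each entry $x$, while the stack is nonempty and its top $t<x$, pop $t$ to the output; then push $x$. At the end, pop the remaining stack elements to the output; the output is $s(\boldsymbol{\pi})$, and $s^k$ is the $k$-fold iterate. -}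

module Defs where

open import Data.Nat using (ℕ; zero; suc; _<ᵇ_; _∸_)
open import Data.Bool using (if_then_else_)
open import Data.Product using (_×_; _,_)
open import Data.List using (List; []; _∷_; reverse; _++_; map; upTo)
open import Data.List.Relation.Binary.Permutation.Propositional using (_↭_)
open import Relation.Binary.PropositionalEquality using (_≡_)

idList : ℕ → List ℕ
idList n = map suc (upTo n)

IsPerm : ℕ → List ℕ → Set
IsPerm n π = π ↭ idList n

-- 1-indexed i-th entry π_i of a list (returns 0 if i = 0 or i > length).
entry : List ℕ → ℕ → ℕ
entry []       _             = 0
entry (x ∷ xs) zero          = 0
entry (x ∷ xs) (suc zero)    = x
entry (x ∷ xs) (suc (suc i)) = entry xs (suc i)

IsLn1 : ℕ → List ℕ → Set
IsLn1 n π = (entry π (n ∸ 1) ≡ n) × (entry π n ≡ 1)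

-- Stack-sorting.  `stk` is the stack with its top at the head,
-- `out` is the output so far, stored reversed.
-- Push x after popping every top t < x.
popSmaller : ℕ → List ℕ → List ℕ → List ℕ × List ℕ
popSmaller x []          out = [] , out
popSmaller x (t ∷ stk)   out =
  if t <ᵇ x then popSmaller x stk (t ∷ out) else (t ∷ stk) , out

stackRun : List ℕ → List ℕ → List ℕ → List ℕ
stackRun []       stk out = reverse out ++ stk
stackRun (x ∷ xs) stk out with popSmaller x stk out
... | stk' , out' = stackRun xs (x ∷ stk') out'

s : List ℕ → List ℕ
s π = stackRun π [] []

iter : ℕ → (List ℕ → List ℕ) → List ℕ → List ℕ
iter zero    f x = x
iter (suc k) f x = f (iter k f x)

module Submission where

-- If m exceeds every entry of L and R, then s(L m R) = s(L) s(R) m: on arrival m pops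
-- the whole stack, and afterwards it stays at the bottom of the stack until the end.
-- Hence s fixes an increasing tail lying above all other entries, and s(β) ends with
-- the maximum of β.  For an Ln1 permutation of length n = k + l + 2 induction on k gives
--   s^k(π) = β (l+2) 1 (l+3) ⋯ n,   β a permutation of 2 ⋯ (l+1),
-- because s(β′ (l+3) 1 (l+4) ⋯ n) = s(β′) 1 (l+3) (l+4) ⋯ n and s(β′) = β (l+2).

open import Defs
open import Data.List using (List)
open import Data.Nat using (ℕ; _≤_; _<_; _∸_)
open import Relation.Binary.PropositionalEquality using (_≡_)
open import Data.Product using (_×_)

module StackSorting where
  open import Data.Bool using (true; false)
  open import Data.Nat using (zero; suc; _+_; _<ᵇ_)
  open import Data.Nat.Properties using (<ᵇ⇒<; <⇒<ᵇ; ≤⇒≯)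
  open import Data.Product using (_,_; proj₁; proj₂; map₁)
  import Data.Product as Product
  open import Data.List using ([]; _∷_; _++_; _∷ʳ_; reverse; foldl)
  open import Data.List.Properties using (++-assoc; ++-identityʳ; foldl-++; unfold-reverse; reverse-++)
  open import Data.List.Relation.Unary.All as All using (All; []; _∷_)
  open import Data.List.Relation.Binary.Permutation.Propositional using (_↭_; ↭-refl; module PermutationReasoning)
  open import Data.List.Relation.Binary.Permutation.Propositional.Properties using (shift) renaming (++⁺ to ↭-++⁺)
  open import Relation.Nullary using (contradiction)
  open import Relation.Binary.PropositionalEquality using (refl; sym; trans; cong; cong₂; module ≡-Reasoning)

  State : Set
  State = List ℕ × List ℕ

  feed : State → ℕ → State
  feed (stk , out) x = map₁ (x ∷_) (popSmaller x stk out)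

  flush : State → List ℕ
  flush (stk , out) = reverse out ++ stk

  stackRun-foldl : ∀ xs stk out → stackRun xs stk out ≡ flush (foldl feed (stk , out) xs)
  stackRun-foldl []       stk out = refl
  stackRun-foldl (x ∷ xs) stk out with popSmaller x stk out
  ... | stk′ , out′ = stackRun-foldl xs (x ∷ stk′) out′

  s-foldl : ∀ xs → s xs ≡ flush (foldl feed ([] , []) xs)
  s-foldl xs = stackRun-foldl xs [] []

  flush-popSmaller : ∀ x stk out → flush (popSmaller x stk out) ≡ flush (stk , out)
  flush-popSmaller x []        out = refl
  flush-popSmaller x (t ∷ stk) out with t <ᵇ x
  ... | false = refl
  ... | true  = begin
    flush (popSmaller x stk (t ∷ out)) ≡⟨ flush-popSmaller x stk (t ∷ out) ⟩
    reverse (t ∷ out) ++ stk           ≡⟨ cong (_++ stk) (unfold-reverse t out) ⟩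
    (reverse out ∷ʳ t) ++ stk          ≡⟨ ++-assoc (reverse out) (t ∷ []) stk ⟩
    reverse out ++ t ∷ stk             ∎
    where open ≡-Reasoning

  flush-feed : ∀ σ x → flush (feed σ x) ↭ x ∷ flush σ
  flush-feed (stk , out) x = begin
    reverse (proj₂ σ′) ++ x ∷ proj₁ σ′ ↭⟨ shift x (reverse (proj₂ σ′)) (proj₁ σ′) ⟩
    x ∷ flush σ′                       ≡⟨ cong (x ∷_) (flush-popSmaller x stk out) ⟩
    x ∷ flush (stk , out)              ∎
    where
    open PermutationReasoning
    σ′ : State
    σ′ = popSmaller x stk out

  flush-foldl : ∀ σ xs → flush (foldl feed σ xs) ↭ xs ++ flush σ
  flush-foldl σ []       = ↭-refl
  flush-foldl σ (x ∷ xs) = begin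
    flush (foldl feed (feed σ x) xs) ↭⟨ flush-foldl (feed σ x) xs ⟩
    xs ++ flush (feed σ x)           ↭⟨ ↭-++⁺ (↭-refl {x = xs}) (flush-feed σ x) ⟩
    xs ++ x ∷ flush σ                ↭⟨ shift x xs (flush σ) ⟩
    x ∷ xs ++ flush σ                ∎
    where open PermutationReasoning

  s-↭ : ∀ xs → s xs ↭ xs
  s-↭ xs = begin
    s xs                             ≡⟨ s-foldl xs ⟩
    flush (foldl feed ([] , []) xs)  ↭⟨ flush-foldl ([] , []) xs ⟩
    xs ++ []                         ≡⟨ ++-identityʳ xs ⟩
    xs                               ∎
    where open PermutationReasoning

  -- Outputs are stored reversed, so the earlier output outˡ goes last.
  onTopOf : List ℕ → List ℕ → State → State
  onTopOf bottom outˡ = Product.map (_++ bottom) (_++ outˡ)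

  popSmaller-onTopOf : ∀ {x m} → x ≤ m → ∀ stk rest out outˡ →
    popSmaller x (stk ++ m ∷ rest) (out ++ outˡ) ≡ onTopOf (m ∷ rest) outˡ (popSmaller x stk out)
  popSmaller-onTopOf {x} {m} x≤m [] rest out outˡ with m <ᵇ x | <ᵇ⇒< m x
  ... | false | _   = refl
  ... | true  | m<x = contradiction (m<x _) (≤⇒≯ x≤m)
  popSmaller-onTopOf {x} x≤m (t ∷ stk) rest out outˡ with t <ᵇ x
  ... | false = refl
  ... | true  = popSmaller-onTopOf x≤m stk rest (t ∷ out) outˡ

  foldl-onTopOf : ∀ {m xs} → All (_≤ m) xs → ∀ rest outˡ σ →
    foldl feed (onTopOf (m ∷ rest) outˡ σ) xs ≡ onTopOf (m ∷ rest) outˡ (foldl feed σ xs)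
  foldl-onTopOf []                  rest outˡ σ           = refl
  foldl-onTopOf {xs = x ∷ xs} (x≤m ∷ xs≤m) rest outˡ (stk , out) =
    trans (cong (λ τ → foldl feed (map₁ (x ∷_) τ) xs) (popSmaller-onTopOf x≤m stk rest out outˡ))
          (foldl-onTopOf xs≤m rest outˡ (feed (stk , out) x))

  flush-onTopOf : ∀ bottom outˡ σ → flush (onTopOf bottom outˡ σ) ≡ reverse outˡ ++ flush σ ++ bottom
  flush-onTopOf bottom outˡ (stk , out) = begin
    reverse (out ++ outˡ) ++ stk ++ bottom           ≡⟨ cong (_++ stk ++ bottom) (reverse-++ out outˡ) ⟩
    (reverse outˡ ++ reverse out) ++ stk ++ bottom   ≡⟨ ++-assoc (reverse outˡ) (reverse out) _ ⟩
    reverse outˡ ++ reverse out ++ stk ++ bottom     ≡⟨ cong (reverse outˡ ++_) (sym (++-assoc (reverse out) stk bottom)) ⟩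
    reverse outˡ ++ (reverse out ++ stk) ++ bottom   ∎
    where open ≡-Reasoning

  popSmaller-preserves-All : ∀ {P : ℕ → Set} x {stk} out → All P stk → All P (proj₁ (popSmaller x stk out))
  popSmaller-preserves-All x out [] = []
  popSmaller-preserves-All x {t ∷ stk} out (pt ∷ ps) with t <ᵇ x
  ... | false = pt ∷ ps
  ... | true  = popSmaller-preserves-All x (t ∷ out) ps

  foldl-preserves-All : ∀ {P : ℕ → Set} {xs} σ → All P xs → All P (proj₁ σ) → All P (proj₁ (foldl feed σ xs))
  foldl-preserves-All σ []         ps = ps
  foldl-preserves-All (stk , out) (px ∷ pxs) ps =
    foldl-preserves-All (feed (stk , out) _) pxs (px ∷ popSmaller-preserves-All _ out ps)

  popSmaller-empties : ∀ {m stk} out → All (_< m) stk → proj₁ (popSmaller m stk out) ≡ []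
  popSmaller-empties out [] = refl
  popSmaller-empties {m} {t ∷ stk} out (t<m ∷ ps) with t <ᵇ m | <⇒<ᵇ t<m
  ... | true | _ = popSmaller-empties (t ∷ out) ps

  s-++-∷ : ∀ {m L R} → All (_< m) L → All (_≤ m) R → s (L ++ m ∷ R) ≡ s L ++ s R ++ m ∷ []
  s-++-∷ {m} {L} {R} L<m R≤m = begin
    s (L ++ m ∷ R)                               ≡⟨ s-foldl (L ++ m ∷ R) ⟩
    flush (foldl feed ([] , []) (L ++ m ∷ R))    ≡⟨ cong flush (foldl-++ feed ([] , []) L (m ∷ R)) ⟩
    flush (foldl feed (feed σL m) R)             ≡⟨ cong (λ τ → flush (foldl feed τ R)) m-empties-stack ⟩
    flush (foldl feed (onTopOf [m] outL ∅) R)    ≡⟨ cong flush (foldl-onTopOf R≤m [] outL ∅) ⟩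
    flush (onTopOf [m] outL (foldl feed ∅ R))    ≡⟨ flush-onTopOf [m] outL (foldl feed ∅ R) ⟩
    reverse outL ++ flush (foldl feed ∅ R) ++ [m] ≡⟨ cong₂ (λ u v → u ++ v ++ [m]) reverse-outL (sym (s-foldl R)) ⟩
    s L ++ s R ++ [m]                            ∎
    where
    open ≡-Reasoning
    ∅ : State
    ∅ = [] , []
    [m] : List ℕ
    [m] = m ∷ []
    σL σm : State
    σL = foldl feed ∅ L
    σm = popSmaller m (proj₁ σL) (proj₂ σL)
    outL : List ℕ
    outL = proj₂ σm
    emptied : proj₁ σm ≡ []
    emptied = popSmaller-empties (proj₂ σL) (foldl-preserves-All ∅ L<m [])
    m-empties-stack : feed σL m ≡ ([m] , outL)
    m-empties-stack = cong (λ stk → m ∷ stk , outL) emptied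
    reverse-outL : reverse outL ≡ s L
    reverse-outL = begin
      reverse outL        ≡⟨ sym (++-identityʳ (reverse outL)) ⟩
      reverse outL ++ []  ≡⟨ cong (reverse outL ++_) (sym emptied) ⟩
      flush σm            ≡⟨ flush-popSmaller m (proj₁ σL) (proj₂ σL) ⟩
      flush σL            ≡⟨ sym (s-foldl L) ⟩
      s L                 ∎

module Ln1 where
  open StackSorting
  open import Data.Nat using (zero; suc; pred; _+_; z≤n; s≤s; s≤s⁻¹)
  open import Data.Nat.Properties
    using (m≤n⇒m<n∨m≡n; ≤-refl; ≤-trans; n<1+n; m<n⇒m<1+n; m≤m+n; +-monoʳ-≤; +-monoʳ-<;
           +-identityʳ; +-suc; +-comm; +-∸-assoc; m+n∸m≡n; m≤n⇒∃[o]m+o≡n; +-cancelˡ-<)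
  open import Data.Product using (_,_; proj₁; proj₂; ∃-syntax; ∃₂)
  open import Data.Sum using (inj₁; inj₂)
  open import Data.List using ([]; _∷_; _++_; _∷ʳ_; applyUpTo; length; take)
  open import Data.List.Properties using (++-assoc; ++-identityʳ; applyUpTo-∷ʳ; map-applyUpTo; length-applyUpTo)
  open import Data.List.Relation.Unary.All as All using (All; []; _∷_)
  open import Data.List.Relation.Unary.All.Properties using (applyUpTo⁺₁) renaming (++⁺ to All-++⁺)
  open import Data.List.Relation.Unary.Any using (here; there)
  open import Data.List.Membership.Propositional using (_∈_)
  open import Data.List.Membership.Propositional.Properties using (∈-applyUpTo⁺)
  open import Data.List.Relation.Binary.Permutation.Propositional
    using (_↭_; ↭-sym; ↭-trans; ↭-reflexive; module PermutationReasoning)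
  open import Data.List.Relation.Binary.Permutation.Propositional.Properties
    using (drop-mid; drop-∷; ∷↭∷ʳ; All-resp-↭; ∈-resp-↭; ↭-length) renaming (++⁺ to ↭-++⁺)
  open import Relation.Binary.PropositionalEquality
    using (refl; sym; trans; cong; cong₂; subst; _≗_; module ≡-Reasoning)

  applyUpTo-cong : ∀ {A : Set} {f g : ℕ → A} → f ≗ g → ∀ n → applyUpTo f n ≡ applyUpTo g n
  applyUpTo-cong f≗g zero    = refl
  applyUpTo-cong f≗g (suc n) = cong₂ _∷_ (f≗g 0) (applyUpTo-cong (λ i → f≗g (suc i)) n)

  range : ℕ → ℕ → List ℕ
  range a = applyUpTo (a +_)

  idList≡range : ∀ n → idList n ≡ range 1 n
  idList≡range n = map-applyUpTo (λ i → i) suc n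

  range-∷ : ∀ a l → range a (suc l) ≡ a ∷ range (suc a) l
  range-∷ a l = cong₂ _∷_ (+-identityʳ a) (applyUpTo-cong (+-suc a) l)

  range-< : ∀ a k → All (_< a + k) (range a k)
  range-< a k = applyUpTo⁺₁ (a +_) k (+-monoʳ-< a)

  range-≤ : ∀ a l → All (_≤ a + l) (range a (suc l))
  range-≤ a l = applyUpTo⁺₁ (a +_) (suc l) (λ i<1+l → +-monoʳ-≤ a (s≤s⁻¹ i<1+l))

  s-++-range : ∀ {a γ} → All (_< a) γ → ∀ k → s (γ ++ range a k) ≡ s γ ++ range a k
  s-++-range {a} {γ} γ<a zero = trans (cong s (++-identityʳ γ)) (sym (++-identityʳ (s γ)))
  s-++-range {a} {γ} γ<a (suc k) = begin
    s (γ ++ range a (suc k))              ≡⟨ cong (λ r → s (γ ++ r)) (sym (applyUpTo-∷ʳ (a +_) k)) ⟩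
    s (γ ++ (range a k ∷ʳ (a + k)))       ≡⟨ cong s (sym (++-assoc γ (range a k) _)) ⟩
    s ((γ ++ range a k) ∷ʳ (a + k))       ≡⟨ s-++-∷ below-a+k [] ⟩
    s (γ ++ range a k) ∷ʳ (a + k)         ≡⟨ cong (_∷ʳ (a + k)) (s-++-range γ<a k) ⟩
    (s γ ++ range a k) ∷ʳ (a + k)         ≡⟨ ++-assoc (s γ) (range a k) _ ⟩
    s γ ++ (range a k ∷ʳ (a + k))         ≡⟨ cong (s γ ++_) (applyUpTo-∷ʳ (a +_) k) ⟩
    s γ ++ range a (suc k)                ∎
    where
    open ≡-Reasoning
    below-a+k : All (_< a + k) (γ ++ range a k)
    below-a+k = All-++⁺ (All.map (λ x<a → ≤-trans x<a (m≤m+n a k)) γ<a) (range-< a k)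

  max-split : ∀ {m xs} → All (_≤ m) xs → m ∈ xs →
    ∃₂ λ ys zs → xs ≡ ys ++ m ∷ zs × All (_< m) ys × All (_≤ m) zs
  max-split (_ ∷ xs≤m) (here refl) = [] , _ , refl , [] , xs≤m
  max-split (x≤m ∷ xs≤m) (there m∈xs) with m≤n⇒m<n∨m≡n x≤m
  ... | inj₂ refl = [] , _ , refl , [] , xs≤m
  ... | inj₁ x<m with max-split xs≤m m∈xs
  ...   | ys , zs , refl , ys<m , zs≤m = _ ∷ ys , zs , refl , x<m ∷ ys<m , zs≤m

  s-ends-with-max : ∀ {a l β} → β ↭ range a (suc l) →
    ∃[ β′ ] β′ ↭ range a l × s β ≡ β′ ∷ʳ (a + l)
  s-ends-with-max {a} {l} β↭ with max-split (All-resp-↭ (↭-sym β↭) (range-≤ a l))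
                                            (∈-resp-↭ (↭-sym β↭) (∈-applyUpTo⁺ (a +_) (n<1+n l)))
  ... | ys , zs , refl , ys<m , zs≤m =
    s ys ++ s zs , β′↭ , trans (s-++-∷ ys<m zs≤m) (sym (++-assoc (s ys) (s zs) _))
    where
    open PermutationReasoning
    β′↭ : s ys ++ s zs ↭ range a l
    β′↭ = begin
      s ys ++ s zs  ↭⟨ ↭-++⁺ (s-↭ ys) (s-↭ zs) ⟩
      ys ++ zs      ↭⟨ drop-mid ys (range a l) (↭-trans β↭ (↭-reflexive (sym (applyUpTo-∷ʳ (a +_) l)))) ⟩
      range a l ++ [] ≡⟨ ++-identityʳ (range a l) ⟩
      range a l     ∎

  drop-∷ʳ : ∀ {x : ℕ} {xs ys} → xs ∷ʳ x ↭ ys ∷ʳ x → xs ↭ ys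
  drop-∷ʳ {x} {xs} {ys} p = drop-∷ (↭-trans (∷↭∷ʳ x xs) (↭-trans p (↭-sym (∷↭∷ʳ x ys))))

  split-last-two : ∀ L (xs : List ℕ) → length xs ≡ 2 + L →
    xs ≡ take L xs ++ entry xs (1 + L) ∷ entry xs (2 + L) ∷ []
  split-last-two zero    (a ∷ b ∷ []) refl = refl
  split-last-two (suc L) (x ∷ xs)     len  = cong (x ∷_) (split-last-two L xs (cong pred len))

  entry-++ : ∀ (xs ys : List ℕ) i → entry (xs ++ ys) (suc (length xs + i)) ≡ entry ys (suc i)
  entry-++ []       ys i = refl
  entry-++ (x ∷ xs) ys i = entry-++ xs ys i

  entry-applyUpTo : ∀ f {k i} → i < k → entry (applyUpTo f k) (suc i) ≡ f i
  entry-applyUpTo f {suc k} {zero}  _         = refl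
  entry-applyUpTo f {suc k} {suc i} (s≤s i<k) = entry-applyUpTo (λ j → f (suc j)) i<k

  Ln1Shape : ℕ → ℕ → List ℕ → Set
  Ln1Shape l k w = ∃[ β ] β ↭ range 2 l × w ≡ β ++ (2 + l) ∷ 1 ∷ range (3 + l) k

  Ln1⇒Ln1Shape : ∀ L π → IsPerm (2 + L) π → IsLn1 (2 + L) π → Ln1Shape L 0 π
  Ln1⇒Ln1Shape L π π↭id (πₙ₋₁≡n , πₙ≡1) = take L π , β↭ , π≡
    where
    π↭ : π ↭ range 1 (2 + L)
    π↭ = subst (π ↭_) (idList≡range (2 + L)) π↭id
    π≡ : π ≡ take L π ++ (2 + L) ∷ 1 ∷ []
    π≡ = trans (split-last-two L π (trans (↭-length π↭) (length-applyUpTo (1 +_) (2 + L))))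
               (cong₂ (λ u v → take L π ++ u ∷ v ∷ []) πₙ₋₁≡n πₙ≡1)
    β↭ : take L π ↭ range 2 L
    β↭ = drop-∷ʳ (drop-∷ʳ (begin
      (take L π ∷ʳ (2 + L)) ∷ʳ 1   ≡⟨ ++-assoc (take L π) (2 + L ∷ []) (1 ∷ []) ⟩
      take L π ++ (2 + L) ∷ 1 ∷ [] ≡⟨ sym π≡ ⟩
      π                            ↭⟨ π↭ ⟩
      range 1 (2 + L)              ≡⟨ range-∷ 1 (suc L) ⟩
      1 ∷ range 2 (suc L)          ≡⟨ cong (1 ∷_) (sym (applyUpTo-∷ʳ (2 +_) L)) ⟩
      1 ∷ (range 2 L ∷ʳ (2 + L))   ↭⟨ ∷↭∷ʳ 1 _ ⟩
      (range 2 L ∷ʳ (2 + L)) ∷ʳ 1  ∎))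
      where open PermutationReasoning

  s-Ln1Shape : ∀ {l k w} → Ln1Shape (suc l) k w → Ln1Shape l (suc k) (s w)
  s-Ln1Shape {l} {k} (β , β↭ , refl) with s-ends-with-max β↭
  ... | β′ , β′↭ , sβ≡β′∷ʳ2+l = β′ , β′↭ , (begin
    s (β ++ (3 + l) ∷ 1 ∷ sorted)                ≡⟨ cong s (sym (++-assoc β ((3 + l) ∷ 1 ∷ []) sorted)) ⟩
    s ((β ++ (3 + l) ∷ 1 ∷ []) ++ sorted)        ≡⟨ s-++-range below-4+l k ⟩
    s (β ++ (3 + l) ∷ 1 ∷ []) ++ sorted          ≡⟨ cong (_++ sorted) (s-++-∷ β<3+l (s≤s z≤n ∷ [])) ⟩
    (s β ++ 1 ∷ (3 + l) ∷ []) ++ sorted          ≡⟨ cong (λ u → (u ++ 1 ∷ (3 + l) ∷ []) ++ sorted) sβ≡β′∷ʳ2+l ⟩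
    ((β′ ∷ʳ (2 + l)) ++ 1 ∷ (3 + l) ∷ []) ++ sorted ≡⟨ ++-assoc (β′ ∷ʳ (2 + l)) (1 ∷ (3 + l) ∷ []) sorted ⟩
    (β′ ∷ʳ (2 + l)) ++ 1 ∷ (3 + l) ∷ sorted      ≡⟨ ++-assoc β′ ((2 + l) ∷ []) (1 ∷ (3 + l) ∷ sorted) ⟩
    β′ ++ (2 + l) ∷ 1 ∷ (3 + l) ∷ sorted         ≡⟨ cong (λ r → β′ ++ (2 + l) ∷ 1 ∷ r) (sym (range-∷ (3 + l) k)) ⟩
    β′ ++ (2 + l) ∷ 1 ∷ range (3 + l) (suc k)    ∎)
    where
    open ≡-Reasoning
    sorted : List ℕ
    sorted = range (4 + l) k
    β<3+l : All (_< 3 + l) β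
    β<3+l = All.map s≤s (All-resp-↭ (↭-sym β↭) (range-≤ 2 l))
    below-4+l : All (_< 4 + l) (β ++ (3 + l) ∷ 1 ∷ [])
    below-4+l = All-++⁺ (All.map m<n⇒m<1+n β<3+l) (≤-refl ∷ s≤s (s≤s z≤n) ∷ [])

  iter-Ln1Shape : ∀ k {l w} → Ln1Shape (k + l) 0 w → Ln1Shape l k (iter k s w)
  iter-Ln1Shape zero    shape = shape
  iter-Ln1Shape (suc k) {l} {w} shape =
    s-Ln1Shape (iter-Ln1Shape k (subst (λ L → Ln1Shape L 0 w) (sym (+-suc k l)) shape))

  Ln1Shape-entries : ∀ {l k w} → Ln1Shape l k w →
    entry w (2 + l) ≡ 1 × (∀ {i} → i < k → entry w (3 + l + i) ≡ 3 + l + i)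
  Ln1Shape-entries {l} {k} (β , β↭ , refl) = entry-one , entry-tail
    where
    |β|≡l : length β ≡ l
    |β|≡l = trans (↭-length β↭) (length-applyUpTo (2 +_) l)
    tail : List ℕ
    tail = (2 + l) ∷ 1 ∷ range (3 + l) k
    entry-one : entry (β ++ tail) (2 + l) ≡ 1
    entry-one = trans (cong (λ p → entry (β ++ tail) (suc p)) (sym (trans (cong (_+ 1) |β|≡l) (+-comm l 1))))
                      (entry-++ β tail 1)
    entry-tail : ∀ {i} → i < k → entry (β ++ tail) (3 + l + i) ≡ 3 + l + i
    entry-tail {i} i<k = begin
      entry (β ++ tail) (3 + l + i)                   ≡⟨ cong (λ p → entry (β ++ tail) (suc p)) position ⟩
      entry (β ++ tail) (suc (length β + (2 + i)))    ≡⟨ entry-++ β tail (2 + i) ⟩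
      entry (range (3 + l) k) (suc i)                 ≡⟨ entry-applyUpTo (3 + l +_) i<k ⟩
      3 + l + i                                       ∎
      where
      open ≡-Reasoning
      position : 2 + l + i ≡ length β + (2 + i)
      position = sym (trans (cong (_+ (2 + i)) |β|≡l) (trans (+-suc l (suc i)) (cong suc (+-suc l i))))

  iter-s-entries : ∀ n → 2 ≤ n → ∀ π → IsPerm n π → IsLn1 n π → ∀ k → k ≤ n ∸ 2 →
    entry (iter k s π) (n ∸ k) ≡ 1 × (∀ j → n ∸ k < j → j ≤ n → entry (iter k s π) j ≡ j)
  iter-s-entries (suc (suc L)) (s≤s (s≤s z≤n)) π π↭id ln1 k k≤L with m≤n⇒∃[o]m+o≡n k≤L
  ... | l , refl with Ln1Shape-entries (iter-Ln1Shape k (Ln1⇒Ln1Shape (k + l) π π↭id ln1))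
  ...   | entry-2+l≡1 , entry-tail = trans (cong (entry (iter k s π)) n∸k≡2+l) entry-2+l≡1 , entry-after
    where
    n∸k≡2+l : 2 + (k + l) ∸ k ≡ 2 + l
    n∸k≡2+l = trans (+-∸-assoc 2 (m≤m+n k l)) (cong (2 +_) (m+n∸m≡n k l))
    entry-after : ∀ j → 2 + (k + l) ∸ k < j → j ≤ 2 + (k + l) → entry (iter k s π) j ≡ j
    entry-after j n∸k<j j≤n with m≤n⇒∃[o]m+o≡n (subst (λ p → suc p ≤ j) n∸k≡2+l n∸k<j)
    ... | i , refl = entry-tail (+-cancelˡ-< l i k (subst (suc (l + i) ≤_) (+-comm k l) (s≤s⁻¹ (s≤s⁻¹ j≤n))))

open Ln1 using (iter-s-entries)
open import Data.Integer using (+_; _-_; -_; _+_)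
open import Data.Integer.Properties using (m-n≡m⊖n; ⊖-≥; i≡j⇒i-j≡0)
open import Data.Integer.Tactic.RingSolver using (solve-∀)
open import Data.Nat.Properties using (≤-trans; m∸n≤m)
open import Relation.Binary.PropositionalEquality using (sym; trans; cong; module ≡-Reasoning)
open import Data.Product using (_,_)

+1-[n∸k]≡-n+k+1 : ∀ {n k} → k ≤ n → + 1 - + (n ∸ k) ≡ - + n + + k + + 1
+1-[n∸k]≡-n+k+1 {n} {k} k≤n = begin
  + 1 - + (n ∸ k)       ≡⟨ cong (λ d → + 1 - d) (sym (trans (m-n≡m⊖n n k) (⊖-≥ k≤n))) ⟩
  + 1 - (+ n - + k)     ≡⟨ ring (+ n) (+ k) ⟩
  - + n + + k + + 1     ∎
  where
  open ≡-Reasoning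
  ring : ∀ a b → + 1 - (a - b) ≡ - a + b + + 1
  ring = solve-∀

lemma4p3 : (n : ℕ) → 2 ≤ n → (π : List ℕ) → IsPerm n π → IsLn1 n π →
    (k : ℕ) → k ≤ n ∸ 2 →
      ((j : ℕ) → n ∸ k < j → j ≤ n →
         (+ entry (iter k s π) j) - (+ j) ≡ + 0)
      × ((+ entry (iter k s π) (n ∸ k)) - (+ (n ∸ k)) ≡ - (+ n) + (+ k) + (+ 1))
lemma4p3 n 2≤n π π↭id ln1 k k≤n∸2 with iter-s-entries n 2≤n π π↭id ln1 k k≤n∸2
... | entry-n∸k≡1 , entry-j≡j =
  (λ j n∸k<j j≤n → i≡j⇒i-j≡0 (cong +_ (entry-j≡j j n∸k<j j≤n))) ,
  (begin
    + entry (iter k s π) (n ∸ k) - + (n ∸ k) ≡⟨ cong (λ e → + e - + (n ∸ k)) entry-n∸k≡1 ⟩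
    + 1 - + (n ∸ k)                          ≡⟨ +1-[n∸k]≡-n+k+1 (≤-trans k≤n∸2 (m∸n≤m n 2)) ⟩
    - + n + + k + + 1                        ∎)
  where open ≡-Reasoning
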